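{- Let $m\in\mathbb{N}$ and let $\{a_n\}_{n=0}^m$ be a sequence in $\mathfrak{G}$ with $|a_n|>1$ for all $n\ge1$, with $\mathcal{Q}$-pair $\{p_n\},\{q_n\}$, and suppose $q_n\ne0$ for all $n\ge0$. Let $1\le n\le m-1$ be such that $|q_{n-1}|\ge\frac{\sqrt5+1}{2}|q_{n-2}|$, and such that either $|a_n|>2$ or $\operatorname{Re}(a_na_{n+1})\ge\chi$, where $\chi=2$ if $|a_{n+1}|=\sqrt2$ and $\chi=0$ otherwise. Then at least one of $|q_n|/|q_{n-1}|$ and $|q_{n+1}|/|q_n|$ is at least $\frac{\sqrt5+1}{2}$.
   Context: $\mathfrak{G}$ is the ring of Gaussian integers. The $\mathcal{Q}$-pair of a finite sequence $\{a_n\}_{n=0}^m$ is $\{p_n\}_{n=-1}^m,\{q_n\}_{n=-1}^m$ with $p_{ -1}=1$, $p_0=a_0$, $p_{n+1}=a_{n+1}p_n+p_{n-1}$, $q_{ -1}=0$, $q_0=1$, $q_{n+1}=a_{n+1}q_n+q_{n-1}$. -}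

module Defs where

open import Data.Nat using (ℕ; zero; suc)
open import Data.Integer using (ℤ; +_; _+_; _-_; _*_; -_; _≤_)
open import Data.Product using (_×_)

record 𝔊 : Set where
  constructor _+i_
  field
    re : ℤ
    im : ℤ
open 𝔊 public

0𝔊 : 𝔊
0𝔊 = (+ 0) +i (+ 0)

1𝔊 : 𝔊
1𝔊 = (+ 1) +i (+ 0)

infixl 6 _⊕_
infixl 7 _⊗_

_⊕_ : 𝔊 → 𝔊 → 𝔊
(a +i b) ⊕ (c +i d) = (a + c) +i (b + d)

_⊗_ : 𝔊 → 𝔊 → 𝔊
(a +i b) ⊗ (c +i d) = (a * c - b * d) +i (a * d + b * c)

-- Squared absolute value |z|² = re² + im² (an integer).
N : 𝔊 → ℤ
N (a +i b) = a * a + b * b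

-- Q-pair of a sequence a (only a 0 … a m matter), with the index
-- shifted by one so that it starts at 0:
--   pp a k = p_{k-1},  qq a k = q_{k-1}.
pp : (ℕ → 𝔊) → ℕ → 𝔊
pp a zero = 1𝔊
pp a (suc zero) = a 0
pp a (suc (suc k)) = a (suc k) ⊗ pp a (suc k) ⊕ pp a k

qq : (ℕ → 𝔊) → ℕ → 𝔊
qq a zero = 0𝔊
qq a (suc zero) = 1𝔊
qq a (suc (suc k)) = a (suc k) ⊗ qq a (suc k) ⊕ qq a k

-- For nonnegative reals X = |x|², Y = |y|² (given as integers):
--   |x| ≥ ((√5+1)/2) |y|  ⟺  X ≥ ((3+√5)/2) Y  ⟺  2X - 3Y ≥ √5 Y
--   ⟺  2X - 3Y ≥ 0  and  (2X - 3Y)² ≥ 5 Y².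
GoldenGe : ℤ → ℤ → Set
GoldenGe X Y =
  (+ 0 ≤ (+ 2) * X - (+ 3) * Y) ×
  ((+ 5) * (Y * Y) ≤ ((+ 2) * X - (+ 3) * Y) * ((+ 2) * X - (+ 3) * Y))

_≥φ·_ : 𝔊 → 𝔊 → Set
x ≥φ· y = GoldenGe (N x) (N y)

χ : 𝔊 → ℤ
χ b with N b
... | + 2 = + 2
... | _ = + 0

module Submission where

-- Write u = q_{n-2}, v = q_{n-1}, a = a_n, b = a_{n+1}, so that
-- w = a v + u = q_n and x = b w + v = (a b + 1) v + b u = q_{n+1}.
-- With U = |u|², V = |v|², t = v ū (so |t|² = UV) both squared norms
-- |w|² and |x|² are forms  αU + βV + 2 Re(k t)  in the data (U, V, t).
-- The hypothesis |v| ≥ φ|u| is used through its rational shadow 34U ≤ 13V,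
-- and "|z| ≥ φ|y|" is established through the sufficient rational test
-- 21|y|² ≤ 8|z|² (21/8 > φ²).  The argument splits on |a|²:
--   * |a|² ≥ 5: |w| ≥ |a||v| − |u| ≥ (√5 − 1/φ)|v| = φ|v|, done exactly in
--     the √5-arithmetic of `_≥√5·_` (the bound is sharp, so no rounding);
--   * |a|² ≤ 4: we show |x| ≥ φ|w|.  If a coordinate of b has absolute value
--     ≥ 3 this follows from x w̄ = b|w|² + v w̄ and |w|² ≥ (4/7)|v|²;
--     otherwise (a, b) is one of finitely many pairs, and for each admissible
--     pair a decision procedure verifies a certificate: coefficients making
--     21|w|² − 8|x|² + 13V − 34U a negative semidefinite form.

open import Defs
open import Data.Nat using (ℕ; suc; _≤_; _∸_; zero; z≤n; s≤s)
import Data.Nat.Properties as ℕP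
open import Data.Integer using (ℤ; +_; -[1+_]; _+_; _-_; _*_; -_; +≤+; -≤+; +<+; _<_; _≤?_; _<?_)
  renaming (_≤_ to _≤ℤ_)
import Data.Integer.Properties as ℤP
open import Data.Integer.Tactic.RingSolver using (solve-∀)
open import Data.List using (List; []; _∷_)
open import Data.List.Membership.Propositional using (_∈_)
open import Data.List.Relation.Unary.Any using (here; there)
open import Data.List.Relation.Unary.All as All using (All; all?)
open import Data.Product using (_×_; _,_)
open import Data.Sum using (_⊎_; inj₁; inj₂; [_,_])
open import Data.Empty using (⊥-elim)
open import Relation.Nullary using (¬_; yes; no)
open import Relation.Nullary.Decidable using (Dec; _×-dec_; _→-dec_; toWitness)
open import Relation.Binary.PropositionalEquality
  using (_≡_; _≢_; refl; sym; trans; cong; subst; subst₂)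

-- Sign bookkeeping in ℤ.  Most inequalities below are proved as
-- "0 ≤ (a visibly nonnegative expression) = (target) by a ring identity".

0≤+ : ∀ n → + 0 ≤ℤ + n
0≤+ n = +≤+ z≤n

1≤+suc : ∀ {n} → + 1 ≤ℤ + suc n
1≤+suc = +≤+ (s≤s z≤n)

0≤-+ : ∀ {x y} → + 0 ≤ℤ x → + 0 ≤ℤ y → + 0 ≤ℤ x + y
0≤-+ = ℤP.+-mono-≤

0≤-* : ∀ {x y} → + 0 ≤ℤ x → + 0 ≤ℤ y → + 0 ≤ℤ x * y
0≤-* {+ m} {y} (+≤+ _) hy =
  subst (_≤ℤ + m * y) (ℤP.*-zeroʳ (+ m)) (ℤP.*-monoˡ-≤-nonNeg (+ m) hy)

0≤-square : ∀ x → + 0 ≤ℤ x * x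
0≤-square (+ n)    = 0≤-* (0≤+ n) (0≤+ n)
0≤-square -[1+ n ] = 0≤+ _

0≤-norm : ∀ z → + 0 ≤ℤ N z
0≤-norm z = 0≤-+ (0≤-square (re z)) (0≤-square (im z))

0≤-≡ : ∀ {x y} → x ≡ y → + 0 ≤ℤ x → + 0 ≤ℤ y
0≤-≡ refl h = h

-- A multiple of a quantity known to vanish; used to insert hypotheses
-- that are equations into a nonnegativity certificate.
0≤-vanishing : ∀ c {x y} → x ≡ y → + 0 ≤ℤ c * (x - y)
0≤-vanishing c {x} refl = 0≤-≡ (sym (vanish c x)) (0≤+ 0)
  where
  vanish : ∀ c x → c * (x - x) ≡ + 0
  vanish = solve-∀

≤⇒0≤- : ∀ {x y} → x ≤ℤ y → + 0 ≤ℤ y - x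
≤⇒0≤- = ℤP.i≤j⇒0≤j-i

0≤-⇒≤ : ∀ {x y} → + 0 ≤ℤ y - x → x ≤ℤ y
0≤-⇒≤ = ℤP.0≤i-j⇒j≤i

<⇒0≤- : ∀ {x y} → x < y → + 0 ≤ℤ y - (+ 1 + x)
<⇒0≤- h = ℤP.i≤j⇒0≤j-i (ℤP.i<j⇒suc[i]≤j h)

0≰negative : ∀ {x n} → x ≡ -[1+ n ] → ¬ (+ 0 ≤ℤ x)
0≰negative refl ()

0≤-cancel : ∀ {c x} → + 1 ≤ℤ c → + 0 ≤ℤ c * x → + 0 ≤ℤ x
0≤-cancel {+ suc n} {x} (+≤+ (s≤s _)) h =
  ℤP.*-cancelˡ-≤-pos (+ 0) x (+ suc n) (subst (_≤ℤ + suc n * x) (sym (ℤP.*-zeroʳ (+ suc n))) h)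

*-mono-≤-0≤ : ∀ {x y} c → + 0 ≤ℤ c → x ≤ℤ y → x * c ≤ℤ y * c
*-mono-≤-0≤ {x} {y} c hc h = 0≤-⇒≤ (0≤-≡ (distrib y x c) (0≤-* (≤⇒0≤- h) hc))
  where
  distrib : ∀ y x c → (y - x) * c ≡ y * c - x * c
  distrib = solve-∀

square-mono : ∀ {p q} → + 0 ≤ℤ q → q ≤ℤ p → q * q ≤ℤ p * p
square-mono {p} {q} hq h =
  0≤-⇒≤ (0≤-≡ (difference p q) (0≤-* (≤⇒0≤- h) (0≤-+ (≤⇒0≤- h) (0≤-* (0≤+ 2) hq))))
  where
  difference : ∀ p q → (p - q) * ((p - q) + + 2 * q) ≡ p * p - q * q
  difference = solve-∀

square-reflect : ∀ {p q} → + 0 ≤ℤ p → q * q ≤ℤ p * p → q ≤ℤ p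
square-reflect {p} {q} hp h with q ≤? p
... | yes q≤p = q≤p
... | no q≰p  = ⊥-elim (0≰negative (expand p q)
      (0≤-+ (≤⇒0≤- h) (0≤-+ (0≤-* (0≤-* (0≤+ 2) hp) (0≤-+ d≥0 (0≤+ 1))) (0≤-* d≥0 (0≤-+ d≥0 (0≤+ 2))))))
  where
  -- q = p + d + 1 with d ≥ 0, so q² − p² ≥ 1.
  d≥0 : + 0 ≤ℤ q - (+ 1 + p)
  d≥0 = <⇒0≤- (ℤP.≰⇒> q≰p)
  expand : ∀ p q → let d = q - (+ 1 + p) in
    (p * p - q * q) + (+ 2 * p * (d + + 1) + d * (d + + 2)) ≡ -[1+ 0 ]
  expand = solve-∀

_≥√5·_ : ℤ → ℤ → Set
x ≥√5· y = (+ 0 ≤ℤ x) × (+ 5 * (y * y) ≤ℤ x * x)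

-- By definition  GoldenGe X Y  is  (2X − 3Y) ≥√5· Y,  i.e. X ≥ φ² Y.

√5-add : ∀ {x₁ y₁ x₂ y₂} → x₁ ≥√5· y₁ → x₂ ≥√5· y₂ → (x₁ + x₂) ≥√5· (y₁ + y₂)
√5-add {x₁} {y₁} {x₂} {y₂} (x₁≥0 , h₁) (x₂≥0 , h₂) =
  0≤-+ x₁≥0 x₂≥0 ,
  0≤-⇒≤ (0≤-≡ (sum-square x₁ y₁ x₂ y₂)
    (0≤-+ (0≤-+ (≤⇒0≤- h₁) (≤⇒0≤- h₂)) (0≤-* (0≤+ 2) (≤⇒0≤- cross))))
  where
  product-square : ∀ x₁ y₁ x₂ y₂ →
    (x₁ * x₁ - + 5 * (y₁ * y₁)) * (x₂ * x₂) + (+ 5 * (y₁ * y₁)) * (x₂ * x₂ - + 5 * (y₂ * y₂))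
      ≡ (x₁ * x₂) * (x₁ * x₂) - (+ 5 * (y₁ * y₂)) * (+ 5 * (y₁ * y₂))
  product-square = solve-∀
  sum-square : ∀ x₁ y₁ x₂ y₂ →
    (x₁ * x₁ - + 5 * (y₁ * y₁)) + (x₂ * x₂ - + 5 * (y₂ * y₂)) + + 2 * (x₁ * x₂ - + 5 * (y₁ * y₂))
      ≡ (x₁ + x₂) * (x₁ + x₂) - + 5 * ((y₁ + y₂) * (y₁ + y₂))
  sum-square = solve-∀
  -- the cross terms: 5 y₁y₂ ≤ x₁x₂, from 25 y₁²y₂² ≤ x₁²x₂²
  cross : + 5 * (y₁ * y₂) ≤ℤ x₁ * x₂
  cross = square-reflect (0≤-* x₁≥0 x₂≥0) (0≤-⇒≤ (0≤-≡ (product-square x₁ y₁ x₂ y₂)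
    (0≤-+ (0≤-* (≤⇒0≤- h₁) (0≤-square x₂)) (0≤-* (0≤-* (0≤+ 5) (0≤-square y₁)) (≤⇒0≤- h₂)))))

-- Rational lower shadow of X ≥ φ² Y:  X/Y ≥ 34/13  (φ² = 2.6180… < 34/13).
golden⇒ratio : ∀ {X Y} → GoldenGe X Y → + 34 * Y ≤ℤ + 13 * X
golden⇒ratio {X} {Y} (x≥0 , h) =
  0≤-⇒≤ (0≤-cancel {+ 2} 1≤+suc (0≤-≡ (rescale X Y) (≤⇒0≤- 29Y≤13x)))
  where
  x = + 2 * X - + 3 * Y
  -- 13 x ≥ 13 √5 Y ≥ 29 Y, since 13² · 5 = 845 ≥ 841 = 29²
  29Y≤13x : + 29 * Y ≤ℤ + 13 * x
  29Y≤13x = square-reflect (0≤-* (0≤+ 13) x≥0)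
    (0≤-⇒≤ (0≤-≡ (squares x Y) (0≤-+ (0≤-* (0≤+ 169) (≤⇒0≤- h)) (0≤-* (0≤+ 4) (0≤-square Y)))))
    where
    squares : ∀ x Y → + 169 * (x * x - + 5 * (Y * Y)) + + 4 * (Y * Y)
      ≡ (+ 13 * x) * (+ 13 * x) - (+ 29 * Y) * (+ 29 * Y)
    squares = solve-∀
  rescale : ∀ X Y → + 13 * (+ 2 * X - + 3 * Y) - + 29 * Y ≡ + 2 * (+ 13 * X - + 34 * Y)
  rescale = solve-∀

-- Rational sufficient test for X ≥ φ² Y:  X/Y ≥ 21/8  (21/8 = 2.625 > φ²).
ratio⇒golden : ∀ {X Y} → + 0 ≤ℤ Y → + 21 * Y ≤ℤ + 8 * X → GoldenGe X Y
ratio⇒golden {X} {Y} Y≥0 h = x≥0 ,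
  0≤-⇒≤ (0≤-cancel {+ 64} 1≤+suc (0≤-≡ (squares x Y)
    (0≤-+ (≤⇒0≤- (square-mono (0≤-* (0≤+ 18) Y≥0) 18Y≤8x)) (0≤-* (0≤+ 4) (0≤-square Y)))))
  where
  x = + 2 * X - + 3 * Y
  -- 8 x = 16X − 24Y ≥ 42Y − 24Y = 18Y
  18Y≤8x : + 18 * Y ≤ℤ + 8 * x
  18Y≤8x = 0≤-⇒≤ (0≤-≡ (rescale X Y) (0≤-* (0≤+ 2) (≤⇒0≤- h)))
    where
    rescale : ∀ X Y → + 2 * (+ 8 * X - + 21 * Y) ≡ + 8 * (+ 2 * X - + 3 * Y) - + 18 * Y
    rescale = solve-∀
  x≥0 : + 0 ≤ℤ x
  x≥0 = 0≤-cancel {+ 8} 1≤+suc (ℤP.≤-trans (0≤-* (0≤+ 18) Y≥0) 18Y≤8x)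
  -- (8x)² ≥ (18Y)² = 324 Y² ≥ 320 Y² = 64 · 5Y²
  squares : ∀ x Y → ((+ 8 * x) * (+ 8 * x) - (+ 18 * Y) * (+ 18 * Y)) + + 4 * (Y * Y)
    ≡ + 64 * (x * x - + 5 * (Y * Y))
  squares = solve-∀

-- v ⊗̄ u = v · ū, the product with the complex conjugate.
_⊗̄_ : 𝔊 → 𝔊 → 𝔊
(v₁ +i v₂) ⊗̄ (u₁ +i u₂) = (v₁ * u₁ + v₂ * u₂) +i (v₂ * u₁ - v₁ * u₂)

_·_ : ℤ → 𝔊 → 𝔊
c · (z₁ +i z₂) = (c * z₁) +i (c * z₂)

norm-⊗ : ∀ a b → N (a ⊗ b) ≡ N a * N b
norm-⊗ (a₁ +i a₂) (b₁ +i b₂) = identity a₁ a₂ b₁ b₂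
  where
  identity : ∀ a₁ a₂ b₁ b₂ → let c₁ = a₁ * b₁ - a₂ * b₂ ; c₂ = a₁ * b₂ + a₂ * b₁ in
    c₁ * c₁ + c₂ * c₂ ≡ (a₁ * a₁ + a₂ * a₂) * (b₁ * b₁ + b₂ * b₂)
  identity = solve-∀

norm-⊗̄ : ∀ v u → N (v ⊗̄ u) ≡ N v * N u
norm-⊗̄ (v₁ +i v₂) (u₁ +i u₂) = identity v₁ v₂ u₁ u₂
  where
  identity : ∀ v₁ v₂ u₁ u₂ → let t₁ = v₁ * u₁ + v₂ * u₂ ; t₂ = v₂ * u₁ - v₁ * u₂ in
    t₁ * t₁ + t₂ * t₂ ≡ (v₁ * v₁ + v₂ * v₂) * (u₁ * u₁ + u₂ * u₂)
  identity = solve-∀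

norm-affine : ∀ a v u → N (a ⊗ v ⊕ u) ≡ N a * N v + N u + + 2 * re (a ⊗ (v ⊗̄ u))
norm-affine (a₁ +i a₂) (v₁ +i v₂) (u₁ +i u₂) = identity a₁ a₂ v₁ v₂ u₁ u₂
  where
  identity : ∀ a₁ a₂ v₁ v₂ u₁ u₂ →
    let w₁ = a₁ * v₁ - a₂ * v₂ + u₁ ; w₂ = a₁ * v₂ + a₂ * v₁ + u₂
        t₁ = v₁ * u₁ + v₂ * u₂      ; t₂ = v₂ * u₁ - v₁ * u₂ in
    w₁ * w₁ + w₂ * w₂
      ≡ (a₁ * a₁ + a₂ * a₂) * (v₁ * v₁ + v₂ * v₂) + (u₁ * u₁ + u₂ * u₂) + + 2 * (a₁ * t₁ - a₂ * t₂)
  identity = solve-∀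

-- κ a b = a b + 1: the coefficient of v in  b (a v + u) + v = κ v + b u.
κ : 𝔊 → 𝔊 → 𝔊
κ a b = a ⊗ b ⊕ 1𝔊

norm-second : ∀ a b u v →
  N (b ⊗ (a ⊗ v ⊕ u) ⊕ v) ≡ N (κ a b) * N v + N b * N u + + 2 * re ((κ a b ⊗̄ b) ⊗ (v ⊗̄ u))
norm-second (a₁ +i a₂) (b₁ +i b₂) (u₁ +i u₂) (v₁ +i v₂) = identity a₁ a₂ b₁ b₂ u₁ u₂ v₁ v₂
  where
  identity : ∀ a₁ a₂ b₁ b₂ u₁ u₂ v₁ v₂ →
    let w₁ = a₁ * v₁ - a₂ * v₂ + u₁  ; w₂ = a₁ * v₂ + a₂ * v₁ + u₂
        x₁ = b₁ * w₁ - b₂ * w₂ + v₁  ; x₂ = b₁ * w₂ + b₂ * w₁ + v₂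
        k₁ = a₁ * b₁ - a₂ * b₂ + + 1 ; k₂ = a₁ * b₂ + a₂ * b₁ + + 0
        m₁ = k₁ * b₁ + k₂ * b₂       ; m₂ = k₂ * b₁ - k₁ * b₂
        t₁ = v₁ * u₁ + v₂ * u₂       ; t₂ = v₂ * u₁ - v₁ * u₂ in
    x₁ * x₁ + x₂ * x₂
      ≡ (k₁ * k₁ + k₂ * k₂) * (v₁ * v₁ + v₂ * v₂) + (b₁ * b₁ + b₂ * b₂) * (u₁ * u₁ + u₂ * u₂)
        + + 2 * (m₁ * t₁ - m₂ * t₂)
  identity = solve-∀

-- For x = b w + v:  x w̄ = b|w|² + v w̄, hence |x|²|w|² = |b|w|² + v w̄|².
norm-cross : ∀ b w v → let r = v ⊗̄ w in
  N (b ⊗ w ⊕ v) * N w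
    ≡ (re b * N w + re r) * (re b * N w + re r) + (im b * N w + im r) * (im b * N w + im r)
norm-cross (b₁ +i b₂) (w₁ +i w₂) (v₁ +i v₂) = identity b₁ b₂ w₁ w₂ v₁ v₂
  where
  identity : ∀ b₁ b₂ w₁ w₂ v₁ v₂ →
    let x₁ = b₁ * w₁ - b₂ * w₂ + v₁ ; x₂ = b₁ * w₂ + b₂ * w₁ + v₂
        W = w₁ * w₁ + w₂ * w₂
        r₁ = v₁ * w₁ + v₂ * w₂      ; r₂ = v₂ * w₁ - v₁ * w₂ in
    (x₁ * x₁ + x₂ * x₂) * W ≡ (b₁ * W + r₁) * (b₁ * W + r₁) + (b₂ * W + r₂) * (b₂ * W + r₂)
  identity = solve-∀

norm-pos : ∀ z → z ≢ 0𝔊 → + 1 ≤ℤ N z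
norm-pos ((+ 0) +i (+ 0))         z≢0 = ⊥-elim (z≢0 refl)
norm-pos ((+ suc n) +i y)        _   = ℤP.+-mono-≤ (square-mono (0≤+ 1) (1≤+suc {n})) (0≤-square y)
norm-pos (-[1+ n ] +i y)         _   = ℤP.+-mono-≤ (square-mono (0≤+ 1) (1≤+suc {n})) (0≤-square y)
norm-pos ((+ 0) +i (+ suc n))    _   = ℤP.+-mono-≤ (0≤+ 0) (square-mono (0≤+ 1) (1≤+suc {n}))
norm-pos ((+ 0) +i -[1+ n ])     _   = ℤP.+-mono-≤ (0≤+ 0) (square-mono (0≤+ 1) (1≤+suc {n}))

re-square≤ : ∀ k t → re (k ⊗ t) * re (k ⊗ t) ≤ℤ N k * N t
re-square≤ k t = subst (re (k ⊗ t) * re (k ⊗ t) ≤ℤ_) (norm-⊗ k t) (≤-+0≤ (0≤-square (im (k ⊗ t))))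
  where
  ≤-+0≤ : ∀ {x y} → + 0 ≤ℤ y → x ≤ℤ x + y
  ≤-+0≤ {x} hy = subst (_≤ℤ x + _) (ℤP.+-identityʳ x) (ℤP.+-monoʳ-≤ x hy)

-- If α, β ≤ 0 and |k|² ≤ αβ, the form  αU + βV + 2 Re(k t)  is ≤ 0 whenever
-- U, V ≥ 0 and |t|² = VU: it is a negative semidefinite Hermitian form
-- evaluated at (√U, √V).
form-nonpos : ∀ α β k t {U V} → α ≤ℤ + 0 → β ≤ℤ + 0 → N k ≤ℤ α * β →
  + 0 ≤ℤ U → + 0 ≤ℤ V → N t ≡ V * U → α * U + β * V + + 2 * re (k ⊗ t) ≤ℤ + 0
form-nonpos α β k t {U} {V} α≤0 β≤0 k≤αβ U≥0 V≥0 ht =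
  0≤-⇒≤ (0≤-≡ (rearrange α β U V c) (≤⇒0≤- 2c≤S))
  where
  c = re (k ⊗ t)
  S = - (α * U + β * V)
  S≥0 : + 0 ≤ℤ S
  S≥0 = 0≤-≡ (negate α β U V) (0≤-+ (0≤-* (ℤP.neg-mono-≤ α≤0) U≥0) (0≤-* (ℤP.neg-mono-≤ β≤0) V≥0))
    where
    negate : ∀ α β U V → (- α) * U + (- β) * V ≡ - (α * U + β * V)
    negate = solve-∀
  -- AM–GM:  S² − 4αβ·VU = (αU − βV)²
  am-gm : + 4 * (α * β * (V * U)) ≤ℤ S * S
  am-gm = 0≤-⇒≤ (0≤-≡ (identity α β U V) (0≤-square (α * U - β * V)))
    where
    identity : ∀ α β U V → (α * U - β * V) * (α * U - β * V)
      ≡ (- (α * U + β * V)) * (- (α * U + β * V)) - + 4 * (α * β * (V * U))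
    identity = solve-∀
  2c≤S : + 2 * c ≤ℤ S
  2c≤S = square-reflect S≥0 (begin
    (+ 2 * c) * (+ 2 * c)     ≡⟨ four-times c ⟩
    + 4 * (c * c)             ≤⟨ ℤP.*-monoˡ-≤-nonNeg (+ 4) (re-square≤ k t) ⟩
    + 4 * (N k * N t)         ≡⟨ cong (λ n → + 4 * (N k * n)) ht ⟩
    + 4 * (N k * (V * U))     ≤⟨ ℤP.*-monoˡ-≤-nonNeg (+ 4) (*-mono-≤-0≤ (V * U) (0≤-* V≥0 U≥0) k≤αβ) ⟩
    + 4 * (α * β * (V * U))   ≤⟨ am-gm ⟩
    S * S                     ∎)
    where
    open ℤP.≤-Reasoning
    four-times : ∀ c → (+ 2 * c) * (+ 2 * c) ≡ + 4 * (c * c)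
    four-times = solve-∀
  rearrange : ∀ α β U V c → - (α * U + β * V) - + 2 * c ≡ + 0 - (α * U + β * V + + 2 * c)
  rearrange = solve-∀

cross-term≤ : ∀ a v u → re (a ⊗ (v ⊗̄ u)) * re (a ⊗ (v ⊗̄ u)) ≤ℤ N a * (N v * N u)
cross-term≤ a v u = subst (λ n → re (a ⊗ (v ⊗̄ u)) * re (a ⊗ (v ⊗̄ u)) ≤ℤ N a * n)
  (norm-⊗̄ v u) (re-square≤ a (v ⊗̄ u))

-- The three estimates.  Throughout, U = |u|², V = |v|², t = v ū and
-- c = Re(a t), so that |a v + u|² = AV + U + 2c with A = |a|².

-- If A ≥ 5 then |a v + u| ≥ φ|v|: morally
-- |w| ≥ √A|v| − |u| ≥ √5|v| − |v|/φ = φ|v|.  Writing P = AV + U + 2c,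
-- we show 2P − 5V + 3U ≥ √5 (V − U) and add  2V − 3U ≥ √5 U  (that is,
-- |v| ≥ φ|u|) to get  2P − 3V ≥ √5 V,  i.e. P ≥ φ² V.
large-a : ∀ {A V U c} → + 5 ≤ℤ A → + 0 ≤ℤ V → + 0 ≤ℤ U → c * c ≤ℤ A * (V * U) →
  GoldenGe V U → GoldenGe (A * V + U + + 2 * c) V
large-a {A} {V} {U} {c} A≥5 V≥0 U≥0 c²≤AVU golden =
  subst₂ _≥√5·_ (sum-x A V U c) (sum-y V U) (√5-add {X} {V - U} {+ 2 * V - + 3 * U} {U} (X≥0 , X²≥5Y²) golden)
  where
  D≥0 : + 0 ≤ℤ A * (V * U) - c * c
  D≥0 = ≤⇒0≤- c²≤AVU
  A-5≥0 : + 0 ≤ℤ A - + 5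
  A-5≥0 = ≤⇒0≤- A≥5
  -- n, M, r and X turn  |w| ≥ √A|v| − |u|  into polynomial inequalities;
  -- the two inputs are n ≥ 0 and M² ≥ 20r², both consequences of c² ≤ AVU
  n = + 25 * U + + 20 * c + + 4 * (A * V)
  M = n + + 5 * U
  r = + 5 * U + + 2 * c
  X = + 2 * (A * V + U + + 2 * c) - + 5 * V + + 3 * U
  -- n ≥ 0, because |20c| ≤ 25U + 4AV by AM–GM
  n≥0 : + 0 ≤ℤ n
  n≥0 = 0≤-≡ (shift A V U c) (≤⇒0≤- (square-reflect
    (0≤-+ (0≤-* (0≤+ 25) U≥0) (0≤-* (0≤+ 4) (0≤-* (ℤP.≤-trans (0≤+ 5) A≥5) V≥0)))
    (0≤-⇒≤ (0≤-≡ (am-gm A V U c) (0≤-+ (0≤-square (+ 25 * U - + 4 * (A * V))) (0≤-* (0≤+ 400) D≥0))))))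
    where
    am-gm : ∀ A V U c → (+ 25 * U - + 4 * (A * V)) * (+ 25 * U - + 4 * (A * V)) + + 400 * (A * (V * U) - c * c)
      ≡ (+ 25 * U + + 4 * (A * V)) * (+ 25 * U + + 4 * (A * V)) - (- (+ 20 * c)) * (- (+ 20 * c))
    am-gm = solve-∀
    shift : ∀ A V U c → (+ 25 * U + + 4 * (A * V)) - (- (+ 20 * c)) ≡ + 25 * U + + 20 * c + + 4 * (A * V)
    shift = solve-∀
  -- M² − 20 r² = (n − 5U)² + 80 (AVU − c²) ≥ 0
  M²≥20r² : + 0 ≤ℤ M * M - + 20 * (r * r)
  M²≥20r² = 0≤-≡ (identity A V U c) (0≤-+ (0≤-square (n - + 5 * U)) (0≤-* (0≤+ 80) D≥0))
    where
    identity : ∀ A V U c → let n = + 25 * U + + 20 * c + + 4 * (A * V) in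
      (n - + 5 * U) * (n - + 5 * U) + + 80 * (A * (V * U) - c * c)
        ≡ (n + + 5 * U) * (n + + 5 * U) - + 20 * ((+ 5 * U + + 2 * c) * (+ 5 * U + + 2 * c))
    identity = solve-∀
  -- hence 10 r ≤ 3 M  (as 20 > 100/9)
  10r≤3M : + 10 * r ≤ℤ + 3 * M
  10r≤3M = square-reflect (0≤-* (0≤+ 3) (0≤-+ n≥0 (0≤-* (0≤+ 5) U≥0)))
    (0≤-⇒≤ (0≤-≡ (identity M r) (0≤-+ (0≤-* (0≤+ 9) M²≥20r²) (0≤-* (0≤+ 80) (0≤-square r)))))
    where
    identity : ∀ M r → + 9 * (M * M - + 20 * (r * r)) + + 80 * (r * r)
      ≡ (+ 3 * M) * (+ 3 * M) - (+ 10 * r) * (+ 10 * r)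
    identity = solve-∀
  -- 5X = n + (6(A − 5) + 5)V ≥ 0
  X≥0 : + 0 ≤ℤ X
  X≥0 = 0≤-cancel {+ 5} 1≤+suc (0≤-≡ (identity A V U c)
    (0≤-+ n≥0 (0≤-* (0≤-+ (0≤-* (0≤+ 6) A-5≥0) (0≤+ 5)) V≥0)))
    where
    identity : ∀ A V U c → (+ 25 * U + + 20 * c + + 4 * (A * V)) + (+ 6 * (A - + 5) + + 5) * V
      ≡ + 5 * (+ 2 * (A * V + U + + 2 * c) - + 5 * V + + 3 * U)
    identity = solve-∀
  -- 20 (X² − 5(V − U)²) = (M² − 20r²) + 4(A − 5)V (3M − 10r) + 16((A − 5)V)² ≥ 0
  X²≥5Y² : + 5 * ((V - U) * (V - U)) ≤ℤ X * X
  X²≥5Y² = 0≤-⇒≤ (0≤-cancel {+ 20} 1≤+suc (0≤-≡ (identity A V U c)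
    (0≤-+ (0≤-+ M²≥20r² (0≤-* (0≤-* (0≤-* (0≤+ 4) A-5≥0) V≥0) (≤⇒0≤- 10r≤3M)))
          (0≤-* (0≤+ 16) (0≤-square ((A - + 5) * V))))))
    where
    identity : ∀ A V U c →
      let n = + 25 * U + + 20 * c + + 4 * (A * V) ; M = n + + 5 * U ; r = + 5 * U + + 2 * c
          X = + 2 * (A * V + U + + 2 * c) - + 5 * V + + 3 * U in
      (M * M - + 20 * (r * r)) + (+ 4 * (A - + 5)) * V * (+ 3 * M - + 10 * r)
        + + 16 * (((A - + 5) * V) * ((A - + 5) * V))
        ≡ + 20 * (X * X - + 5 * ((V - U) * (V - U)))
    identity = solve-∀
  sum-x : ∀ A V U c → (+ 2 * (A * V + U + + 2 * c) - + 5 * V + + 3 * U) + (+ 2 * V - + 3 * U)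
    ≡ + 2 * (A * V + U + + 2 * c) - + 3 * V
  sum-x = solve-∀
  sum-y : ∀ V U → (V - U) + U ≡ V
  sum-y = solve-∀

-- Lower bound for |a|² ≥ 2:  |a v + u|² ≥ (4/7)|v|².  Indeed
-- 3(7P − 4V) = (13V − 34U) − F  for the nonpositive form F with
-- α = −55, β = 25 − 21A, k = −21a  (|k|² = 441A ≤ αβ iff A ≥ 1375/714).
lower-bound : ∀ a t {U V} → + 2 ≤ℤ N a → + 0 ≤ℤ U → + 0 ≤ℤ V → N t ≡ V * U →
  + 34 * U ≤ℤ + 13 * V → + 4 * V ≤ℤ + 7 * (N a * V + U + + 2 * re (a ⊗ t))
lower-bound (a₁ +i a₂) (t₁ +i t₂) {U} {V} A≥2 U≥0 V≥0 ht golden =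
  0≤-⇒≤ (0≤-cancel {+ 3} 1≤+suc (0≤-≡ (combine a₁ a₂ t₁ t₂ U V)
    (0≤-+ (≤⇒0≤- golden) (≤⇒0≤- (form-nonpos α β k (t₁ +i t₂) α≤0 β≤0 k²≤αβ U≥0 V≥0 ht)))))
  where
  A = a₁ * a₁ + a₂ * a₂
  α = -[1+ 54 ]
  β = + 25 - + 21 * A
  k = -[1+ 20 ] · (a₁ +i a₂)
  α≤0 : α ≤ℤ + 0
  α≤0 = -≤+
  β≤0 : β ≤ℤ + 0
  β≤0 = 0≤-⇒≤ (0≤-≡ (identity A) (0≤-+ (0≤-* (0≤+ 21) (≤⇒0≤- A≥2)) (0≤+ 17)))
    where
    identity : ∀ A → + 21 * (A - + 2) + + 17 ≡ + 0 - (+ 25 - + 21 * A)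
    identity = solve-∀
  k²≤αβ : N k ≤ℤ α * β
  k²≤αβ = 0≤-⇒≤ (0≤-≡ (identity a₁ a₂) (0≤-+ (0≤-* (0≤+ 714) (≤⇒0≤- A≥2)) (0≤+ 53)))
    where
    identity : ∀ a₁ a₂ → let A = a₁ * a₁ + a₂ * a₂ in
      + 714 * (A - + 2) + + 53
        ≡ -[1+ 54 ] * (+ 25 - + 21 * A) - ((-[1+ 20 ] * a₁) * (-[1+ 20 ] * a₁) + (-[1+ 20 ] * a₂) * (-[1+ 20 ] * a₂))
    identity = solve-∀
  combine : ∀ a₁ a₂ t₁ t₂ U V → let A = a₁ * a₁ + a₂ * a₂ in
    (+ 13 * V - + 34 * U)
      + (+ 0 - (-[1+ 54 ] * U + (+ 25 - + 21 * A) * V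
                + + 2 * ((-[1+ 20 ] * a₁) * t₁ - (-[1+ 20 ] * a₂) * t₂)))
      ≡ + 3 * (+ 7 * (A * V + U + + 2 * (a₁ * t₁ - a₂ * t₂)) - + 4 * V)
  combine = solve-∀

-- If x w̄ = b P + r with P = |w|², |r|² = VP and
-- 4V ≤ 7P, and the coordinate b satisfies b² ≥ 9, then |x|² ≥ (21/8) P:
-- the coordinate b P + r alone has size ≥ 3P − √(7/4) P.
large-b : ∀ b b' r r' {P V X} → + 9 ≤ℤ b * b → + 1 ≤ℤ P → + 4 * V ≤ℤ + 7 * P →
  r * r + r' * r' ≡ V * P → X * P ≡ (b * P + r) * (b * P + r) + (b' * P + r') * (b' * P + r') →
  + 21 * P ≤ℤ + 8 * X
large-b b b' r r' {P} {V} {X} b²≥9 P≥1 4V≤7P hr hX =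
  0≤-⇒≤ (0≤-cancel {+ 18} 1≤+suc (0≤-≡ (rescale P X) (0≤-+ 144X≥405P (0≤-* (0≤+ 27) P≥0))))
  where
  P≥0 : + 0 ≤ℤ P
  P≥0 = ℤP.≤-trans (0≤+ 1) P≥1
  -- P (144X − 405P) is a sum of nonnegative terms and multiples of the
  -- two vanishing hypotheses
  144X≥405P : + 0 ≤ℤ + 144 * X - + 405 * P
  144X≥405P = 0≤-cancel P≥1 (0≤-≡ (expand b b' P r r' V X)
    (0≤-+ (0≤-+ (0≤-+ (0≤-+ (0≤-+ (0≤-+
      (0≤-* (0≤+ 4) (0≤-square (+ 4 * (b * P) + + 9 * r)))
      (0≤-* (0≤+ 80) (0≤-* (0≤-square P) (≤⇒0≤- b²≥9))))
      (0≤-* (0≤-* (0≤+ 45) P≥0) (≤⇒0≤- 4V≤7P)))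
      (0≤-* (0≤+ 180) (0≤-square r')))
      (0≤-* (0≤+ 144) (0≤-square (b' * P + r'))))
      (0≤-vanishing (+ 144) hX))
      (0≤-vanishing (+ 180) (sym hr))))
    where
    expand : ∀ b b' P r r' V X →
      + 4 * ((+ 4 * (b * P) + + 9 * r) * (+ 4 * (b * P) + + 9 * r)) + + 80 * ((P * P) * (b * b - + 9))
      + (+ 45 * P) * (+ 7 * P - + 4 * V) + + 180 * (r' * r') + + 144 * ((b' * P + r') * (b' * P + r'))
      + + 144 * (X * P - ((b * P + r) * (b * P + r) + (b' * P + r') * (b' * P + r')))
      + + 180 * (V * P - (r * r + r' * r'))
        ≡ P * (+ 144 * X - + 405 * P)
    expand = solve-∀
  rescale : ∀ P X → (+ 144 * X - + 405 * P) + + 27 * P ≡ + 18 * (+ 8 * X - + 21 * P)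
  rescale = solve-∀

-- For a pair (a, b), with κ = a b + 1 and m = κ b̄, the
-- combination  (13V − 34U) + 21|w|² − 8|x|²  is the form with coefficients
--   α = −13 − 8|b|²,  β = 13 + 21|a|² − 8|κ|²,  k = 21a − 8m.
certα : 𝔊 → ℤ
certα b = -[1+ 12 ] - + 8 * N b

certβ : 𝔊 → 𝔊 → ℤ
certβ a b = + 13 + + 21 * N a - + 8 * N (κ a b)

certk : 𝔊 → 𝔊 → 𝔊
certk a b = (+ 21 * re a - + 8 * re (κ a b ⊗̄ b)) +i (+ 21 * im a - + 8 * im (κ a b ⊗̄ b))

Certificate : 𝔊 → 𝔊 → Set
Certificate a b = (certα b ≤ℤ + 0) × (certβ a b ≤ℤ + 0) × (N (certk a b) ≤ℤ certα b * certβ a b)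

small-case : ∀ a b t {U V} → Certificate a b → + 0 ≤ℤ U → + 0 ≤ℤ V → N t ≡ V * U →
  + 34 * U ≤ℤ + 13 * V →
  + 21 * (N a * V + U + + 2 * re (a ⊗ t))
    ≤ℤ + 8 * (N (κ a b) * V + N b * U + + 2 * re ((κ a b ⊗̄ b) ⊗ t))
small-case a b t {U} {V} (α≤0 , β≤0 , k²≤αβ) U≥0 V≥0 ht golden =
  0≤-⇒≤ (0≤-≡ (combine (re a) (im a) (re m) (im m) (re t) (im t) (N a) (N b) (N (κ a b)) U V)
    (0≤-+ (≤⇒0≤- golden) (≤⇒0≤- (form-nonpos (certα b) (certβ a b) (certk a b) t α≤0 β≤0 k²≤αβ U≥0 V≥0 ht))))
  where
  m = κ a b ⊗̄ b
  combine : ∀ a₁ a₂ m₁ m₂ t₁ t₂ A B K U V →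
    (+ 13 * V - + 34 * U)
      + (+ 0 - ((-[1+ 12 ] - + 8 * B) * U + (+ 13 + + 21 * A - + 8 * K) * V
                + + 2 * ((+ 21 * a₁ - + 8 * m₁) * t₁ - (+ 21 * a₂ - + 8 * m₂) * t₂)))
      ≡ + 8 * (K * V + B * U + + 2 * (m₁ * t₁ - m₂ * t₂)) - + 21 * (A * V + U + + 2 * (a₁ * t₁ - a₂ * t₂))
  combine = solve-∀

Admissible : 𝔊 → 𝔊 → Set
Admissible a b = (+ 2 ≤ℤ N a) × (N a ≤ℤ + 4) × (+ 2 ≤ℤ N b) × (χ b ≤ℤ re (a ⊗ b))

digits : List ℤ
digits = -[1+ 1 ] ∷ -[1+ 0 ] ∷ + 0 ∷ + 1 ∷ + 2 ∷ []

digit : ∀ x → ¬ (+ 9 ≤ℤ x * x) → x ∈ digits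
digit -[1+ 1 ]           _  = here refl
digit -[1+ 0 ]           _  = there (here refl)
digit (+ 0)              _  = there (there (here refl))
digit (+ 1)              _  = there (there (there (here refl)))
digit (+ 2)              _  = there (there (there (there (here refl))))
digit (+ suc (suc (suc n))) x²<9 = ⊥-elim (x²<9 (square-mono (0≤+ 3) (+≤+ (s≤s (s≤s (s≤s z≤n))))))
digit -[1+ suc (suc n) ] x²<9 = ⊥-elim (x²<9 (square-mono (0≤+ 3) (+≤+ (s≤s (s≤s (s≤s z≤n))))))

all-certified : All (λ a₁ → All (λ a₂ → All (λ b₁ → All (λ b₂ →
  Admissible (a₁ +i a₂) (b₁ +i b₂) → Certificate (a₁ +i a₂) (b₁ +i b₂)) digits) digits) digits) digits
all-certified = toWitness {a? = all? (λ a₁ → all? (λ a₂ → all? (λ b₁ → all? (λ b₂ →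
  admissible? (a₁ +i a₂) (b₁ +i b₂) →-dec certificate? (a₁ +i a₂) (b₁ +i b₂)) digits) digits) digits) digits} _
  where
  admissible? : ∀ a b → Dec (Admissible a b)
  admissible? a b = (+ 2 ≤? N a) ×-dec (N a ≤? + 4) ×-dec (+ 2 ≤? N b) ×-dec (χ b ≤? re (a ⊗ b))
  certificate? : ∀ a b → Dec (Certificate a b)
  certificate? a b = (certα b ≤? + 0) ×-dec (certβ a b ≤? + 0) ×-dec (N (certk a b) ≤? certα b * certβ a b)

-- An admissible pair in which b has no coordinate of absolute value ≥ 3 is
-- certified (a has none either, since |a|² ≤ 4).
certified : ∀ a b → Admissible a b → ¬ (+ 9 ≤ℤ re b * re b) → ¬ (+ 9 ≤ℤ im b * im b) → Certificate a b
certified (a₁ +i a₂) (b₁ +i b₂) adm@(_ , A≤4 , _) b₁small b₂small =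
  All.lookup (All.lookup (All.lookup (All.lookup all-certified
    (digit a₁ (coordinate-small a₁ a₂ A≤4)))
    (digit a₂ (coordinate-small a₂ a₁ (subst (_≤ℤ + 4) (ℤP.+-comm (a₁ * a₁) (a₂ * a₂)) A≤4))))
    (digit b₁ b₁small)) (digit b₂ b₂small) adm
  where
  coordinate-small : ∀ x y → x * x + y * y ≤ℤ + 4 → ¬ (+ 9 ≤ℤ x * x)
  coordinate-small x y N≤4 9≤x² = ℤP.<⇒≱ (ℤP.≤-<-trans N≤4 (+<+ (s≤s (s≤s (s≤s (s≤s (s≤s z≤n)))))))
    (ℤP.≤-trans 9≤x² (subst (_≤ℤ x * x + y * y) (ℤP.+-identityʳ (x * x)) (ℤP.+-monoʳ-≤ (x * x) (0≤-square y))))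

small-a : ∀ a b u v → Admissible a b → + 1 ≤ℤ N (a ⊗ v ⊕ u) → GoldenGe (N v) (N u) →
  + 21 * N (a ⊗ v ⊕ u) ≤ℤ + 8 * N (b ⊗ (a ⊗ v ⊕ u) ⊕ v)
small-a a b u v adm@(A≥2 , _) P≥1 golden = by-size (+ 9 ≤? re b * re b) (+ 9 ≤? im b * im b)
  where
  w = a ⊗ v ⊕ u
  r = v ⊗̄ w
  34U≤13V : + 34 * N u ≤ℤ + 13 * N v
  34U≤13V = golden⇒ratio golden
  4V≤7P : + 4 * N v ≤ℤ + 7 * N w
  4V≤7P = subst (λ P → + 4 * N v ≤ℤ + 7 * P) (sym (norm-affine a v u))
    (lower-bound a (v ⊗̄ u) A≥2 (0≤-norm u) (0≤-norm v) (norm-⊗̄ v u) 34U≤13V)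
  by-size : Dec (+ 9 ≤ℤ re b * re b) → Dec (+ 9 ≤ℤ im b * im b) → + 21 * N w ≤ℤ + 8 * N (b ⊗ w ⊕ v)
  by-size (yes b₁big) _ =
    large-b (re b) (im b) (re r) (im r) b₁big P≥1 4V≤7P (norm-⊗̄ v w) (norm-cross b w v)
  by-size (no _) (yes b₂big) =
    large-b (im b) (re b) (im r) (re r) b₂big P≥1 4V≤7P
      (trans (ℤP.+-comm (im r * im r) (re r * re r)) (norm-⊗̄ v w))
      (trans (norm-cross b w v) (ℤP.+-comm ((re b * N w + re r) * (re b * N w + re r))
                                       ((im b * N w + im r) * (im b * N w + im r))))
  by-size (no b₁small) (no b₂small) =
    subst₂ (λ P X → + 21 * P ≤ℤ + 8 * X) (sym (norm-affine a v u)) (sym (norm-second a b u v))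
      (small-case a b (v ⊗̄ u) (certified a b adm b₁small b₂small) (0≤-norm u) (0≤-norm v) (norm-⊗̄ v u) 34U≤13V)

golden-step : ∀ a b u v → + 1 < N a → + 1 < N b → (a ⊗ v ⊕ u) ≢ 0𝔊 → v ≥φ· u →
  (+ 4 < N a ⊎ χ b ≤ℤ re (a ⊗ b)) →
  (a ⊗ v ⊕ u) ≥φ· v ⊎ (b ⊗ (a ⊗ v ⊕ u) ⊕ v) ≥φ· (a ⊗ v ⊕ u)
golden-step a b u v 1<A 1<B w≢0 golden cond = by-size (+ 4 <? N a)
  where
  w = a ⊗ v ⊕ u
  by-size : Dec (+ 4 < N a) → w ≥φ· v ⊎ (b ⊗ w ⊕ v) ≥φ· w
  by-size (yes 4<A) = inj₁ (subst (λ P → GoldenGe P (N v)) (sym (norm-affine a v u))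
    (large-a (ℤP.i<j⇒suc[i]≤j 4<A) (0≤-norm v) (0≤-norm u) (cross-term≤ a v u) golden))
  by-size (no 4≮A) = inj₂ (ratio⇒golden (0≤-norm w) (small-a a b u v adm (norm-pos w w≢0) golden))
    where
    adm : Admissible a b
    adm = ℤP.i<j⇒suc[i]≤j 1<A , ℤP.≮⇒≥ 4≮A , ℤP.i<j⇒suc[i]≤j 1<B ,
          [ (λ 4<A → ⊥-elim (4≮A 4<A)) , (λ χ≤re → χ≤re) ] cond

-- Corollary 5.2.  In the shifted indexing of Defs (qq a k = q_{k−1}) the
-- step above applies with a = a_n, b = a_{n+1}, u = q_{n−2}, v = q_{n−1}.
corollary5p2 : (m : ℕ) (a : ℕ → 𝔊) →
    (∀ k → 1 ≤ k → k ≤ m → + 1 < N (a k)) →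
    (∀ k → k ≤ m → qq a (suc k) ≢ 0𝔊) →
    (n : ℕ) → 1 ≤ n → suc n ≤ m →
    qq a n ≥φ· qq a (n ∸ 1) →
    (+ 4 < N (a n) ⊎ χ (a (suc n)) ≤ℤ re (a n ⊗ a (suc n))) →
    (qq a (suc n) ≥φ· qq a n) ⊎ (qq a (suc (suc n)) ≥φ· qq a (suc n))
corollary5p2 m a |a|>1 q≢0 zero () n<m golden cond
corollary5p2 m a |a|>1 q≢0 (suc k) 1≤n n<m golden cond =
  golden-step (a (suc k)) (a (suc (suc k))) (qq a k) (qq a (suc k))
    (|a|>1 (suc k) 1≤n (ℕP.<⇒≤ n<m))
    (|a|>1 (suc (suc k)) (s≤s z≤n) n<m)
    (q≢0 (suc k) (ℕP.<⇒≤ n<m))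
    golden cond
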